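{- Let $k\ge 2$ be an integer. A square matrix $A$ with all entries in $\{0,1\}$ satisfies $A^k=A$ if and only if either $A=0$ or $A$ is permutation similar to a block matrix $$\begin{pmatrix} 0 & X & XP^TY\\ 0 & P & Y\\ 0 & 0 & 0\end{pmatrix},$$ where the two diagonal zero blocks are square zero matrices (each of which may be vacuous, i.e. of order $0$), $P=C_{n_1}\oplus C_{n_2}\oplus\cdots\oplus C_{n_r}$ with $n_i\mid k-1$ for $i=1,\ldots,r$, and $X$ and $Y$ are matrices with entries in $\{0,1\}$ such that $XP^TY$ also has all entries in $\{0,1\}$.
   Context: $C_m$ denotes the $m\times m$ basic circulant matrix, i.e. the adjacency matrix of the directed cycle on $m$ vertices: $C_m(i,i+1)=1$ for $1\le i\le m-1$, $C_m(m,1)=1$, all other entries $0$ (so $C_1=(1)$). $\oplus$ denotes the direct sum (block diagonal matrix). Two square matrices are permutation similar if $B=Q^TAQ$ for some permutation matrix $Q$. -}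

module Defs where

open import Data.Nat using (ℕ; zero; suc; _+_; _*_; _%_)
open import Data.Fin using (Fin; toℕ; splitAt)
import Data.Fin.Properties as FinP
open import Data.Fin.Permutation using (Permutation; _⟨$⟩ʳ_)
open import Data.Sum using (_⊎_; inj₁; inj₂)
open import Data.List using (List; []; _∷_)
open import Data.Nat.ListAction using (sum)
open import Relation.Binary.PropositionalEquality using (_≡_)
open import Relation.Nullary using (yes; no)
open import Data.Product using (Σ; ∃; _×_)

Mat : ℕ → ℕ → Set
Mat m n = Fin m → Fin n → ℕ

Σ< : (n : ℕ) → (Fin n → ℕ) → ℕ
Σ< zero    f = 0
Σ< (suc n) f = f Fin.zero + Σ< n (λ i → f (Fin.suc i))

_⊗_ : ∀ {m n p} → Mat m n → Mat n p → Mat m p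
_⊗_ {n = n} A B i j = Σ< n (λ l → A i l * B l j)

infixl 7 _⊗_

_ᵀ : ∀ {m n} → Mat m n → Mat n m
(A ᵀ) i j = A j i

zeroM : ∀ {m n} → Mat m n
zeroM _ _ = 0

idM : ∀ {n} → Mat n n
idM i j with i FinP.≟ j
... | yes _ = 1
... | no  _ = 0

_^^_ : ∀ {n} → Mat n n → ℕ → Mat n n
A ^^ zero  = idM
A ^^ suc k = A ⊗ (A ^^ k)

_≈M_ : ∀ {m n} → Mat m n → Mat m n → Set
A ≈M B = ∀ i j → A i j ≡ B i j

IsBinary : ∀ {m n} → Mat m n → Set
IsBinary A = ∀ i j → A i j ≡ 0 ⊎ A i j ≡ 1

block2 : ∀ {m₁ m₂ n₁ n₂} → Mat m₁ n₁ → Mat m₁ n₂ → Mat m₂ n₁ → Mat m₂ n₂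
       → Mat (m₁ + m₂) (n₁ + n₂)
block2 {m₁} {m₂} {n₁} {n₂} A B C D i j with splitAt m₁ i | splitAt n₁ j
... | inj₁ i' | inj₁ j' = A i' j'
... | inj₁ i' | inj₂ j' = B i' j'
... | inj₂ i' | inj₁ j' = C i' j'
... | inj₂ i' | inj₂ j' = D i' j'

block3 : ∀ {a b c}
       → Mat a a → Mat a b → Mat a c
       → Mat b a → Mat b b → Mat b c
       → Mat c a → Mat c b → Mat c c
       → Mat (a + (b + c)) (a + (b + c))
block3 A₁₁ A₁₂ A₁₃ A₂₁ A₂₂ A₂₃ A₃₁ A₃₂ A₃₃ =
  block2 A₁₁ (row A₁₂ A₁₃) (col A₂₁ A₃₁) (block2 A₂₂ A₂₃ A₃₂ A₃₃)
  where
  row : ∀ {p q r} → Mat p q → Mat p r → Mat p (q + r)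
  row {q = q} B C i j with splitAt q j
  ... | inj₁ j' = B i j'
  ... | inj₂ j' = C i j'
  col : ∀ {p q r} → Mat p r → Mat q r → Mat (p + q) r
  col {p = p} B C i j with splitAt p i
  ... | inj₁ i' = B i' j
  ... | inj₂ i' = C i' j

_⊕_ : ∀ {m n} → Mat m m → Mat n n → Mat (m + n) (m + n)
A ⊕ B = block2 A zeroM zeroM B

-- basic circulant C_m: C(i,i+1)=1, C(m,1)=1 (0-indexed: j ≡ (i+1) mod m)
circ : (m : ℕ) → Mat m m
circ zero    ()
circ (suc m) i j with toℕ j Data.Nat.≟ ((suc (toℕ i)) % suc m)
... | yes _ = 1
... | no  _ = 0

circSum : (ns : List ℕ) → Mat (sum ns) (sum ns)
circSum []       = zeroM
circSum (n ∷ ns) = circ n ⊕ circSum ns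

permMat : ∀ {n m} → Permutation n m → Mat n m
permMat π i j with (π ⟨$⟩ʳ i) FinP.≟ j
... | yes _ = 1
... | no  _ = 0

PermSimilar : ∀ {n m} → Mat n n → Mat m m → Set
PermSimilar {n} {m} A B =
  Σ (Permutation n m) λ π → B ≈M ((permMat π ᵀ) ⊗ A ⊗ permMat π)

-- Put E = A^(k-1). Then E E = E and A E = E A = A, and for a nonnegative idempotent E the relation
-- x ↝ y (E x y ≥ 1) is transitive and interpolative; two distinct vertices with loops cannot be joined,
-- since E x y ≥ E x x E x y + E x y E y y would exceed E x y. Pigeonhole then shows that every vertex
-- with an incoming and an outgoing edge of A lies on a loop ("is cyclic"). Because A is 0-1 and A = A E,
-- a cyclic vertex has exactly one cyclic successor σ x, σ permutes the cyclic vertices, and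
-- σ^(k-1) = id; its orbits give P = C_{n_1} ⊕ ⋯ ⊕ C_{n_r} with n_i ∣ k - 1. The remaining vertices are
-- sources (no incoming edge) and sinks (an incoming edge, hence no outgoing one); X and Y record the
-- edges source → cycle and cycle → sink, and expanding A = A E through the cycles gives the
-- source → sink block X Pᵀ Y. Conversely such a block matrix B satisfies B^k = B since P^(k-1) = I.

module Submission where

open import Defs
import Algebra.Properties.Semiring.Sum as SemiringSum
open import Data.Empty using (⊥-elim)
open import Data.Fin using (Fin; toℕ; splitAt; _↑ˡ_; _↑ʳ_; fromℕ<; fromℕ; inject₁) renaming (zero to fz; suc to fs)
import Data.Fin.Properties as FP
open import Data.Fin.Permutation using (Permutation; _⟨$⟩ʳ_; _⟨$⟩ˡ_; inverseˡ; inverseʳ; permutation; flip)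
open import Data.List using (List; []; _∷_; allFin)
open import Data.List.Membership.Propositional using (_∈_)
open import Data.List.Membership.Propositional.Properties using (∈-allFin)
open import Data.List.Relation.Unary.All as All using (All; []; _∷_)
open import Data.List.Relation.Unary.Any using (here; there)
open import Data.Nat using (ℕ; zero; suc; _+_; _*_; _≤_; _<_; _∸_; z≤n; s≤s; s≤s⁻¹; _%_; _/_; NonZero; >-nonZero; _≤?_; _≟_)
open import Data.Nat.DivMod
open import Data.Nat.Divisibility using (_∣_; m%n≡0⇒n∣m)
open import Data.Nat.GeneralisedArithmetic using (fold; fold-+)
open import Data.Nat.ListAction using (sum)
open import Data.Nat.Properties
open import Data.Product using (Σ; ∃; _×_; _,_; proj₁; proj₂; map; map₂)
open import Data.Sum using (_⊎_; inj₁; inj₂)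
open import Data.Vec.Functional using (_++_)
open import Data.Vec.Functional.Properties using (lookup-++ˡ; lookup-++ʳ)
open import Function using (_∘_; case_of_)
open import Function.Bundles using (_⇔_; mk⇔)
open import Relation.Binary.PropositionalEquality
open import Relation.Nullary using (¬_; Dec; yes; no)
open import Relation.Nullary.Decidable using (_×-dec_; ¬?; decidable-stable)

-- Finite sums

private
  module ∑ = SemiringSum +-*-semiring

Σ<≡sum : ∀ n (f : Fin n → ℕ) → Σ< n f ≡ ∑.sum f
Σ<≡sum zero    f = refl
Σ<≡sum (suc n) f = cong (f fz +_) (Σ<≡sum n (f ∘ fs))

Σ<-cong : ∀ n {f g : Fin n → ℕ} → (∀ i → f i ≡ g i) → Σ< n f ≡ Σ< n g
Σ<-cong zero    e = refl
Σ<-cong (suc n) e = cong₂ _+_ (e fz) (Σ<-cong n (e ∘ fs))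

Σ<-zero : ∀ n {f : Fin n → ℕ} → (∀ i → f i ≡ 0) → Σ< n f ≡ 0
Σ<-zero n e = trans (Σ<-cong n e) (trans (Σ<≡sum n _) (∑.sum-replicate-zero n))

Σ<-*ˡ : ∀ n c (f : Fin n → ℕ) → Σ< n (λ i → c * f i) ≡ c * Σ< n f
Σ<-*ˡ n c f = begin
  Σ< n (λ i → c * f i) ≡⟨ Σ<≡sum n _ ⟩
  ∑.sum (λ i → c * f i) ≡⟨ ∑.*-distribˡ-sum c f ⟨
  c * ∑.sum f          ≡⟨ cong (c *_) (Σ<≡sum n f) ⟨
  c * Σ< n f           ∎
  where open ≡-Reasoning

Σ<-*ʳ : ∀ n c (f : Fin n → ℕ) → Σ< n (λ i → f i * c) ≡ Σ< n f * c
Σ<-*ʳ n c f = begin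
  Σ< n (λ i → f i * c) ≡⟨ Σ<-cong n (λ i → *-comm (f i) c) ⟩
  Σ< n (λ i → c * f i) ≡⟨ Σ<-*ˡ n c f ⟩
  c * Σ< n f           ≡⟨ *-comm c _ ⟩
  Σ< n f * c           ∎
  where open ≡-Reasoning

Σ<-comm : ∀ m n (f : Fin m → Fin n → ℕ) →
          Σ< m (λ i → Σ< n (f i)) ≡ Σ< n (λ j → Σ< m (λ i → f i j))
Σ<-comm m n f = begin
  Σ< m (λ i → Σ< n (f i))             ≡⟨ Σ<-cong m (λ i → Σ<≡sum n (f i)) ⟩
  Σ< m (λ i → ∑.sum (f i))            ≡⟨ Σ<≡sum m _ ⟩
  ∑.sum (λ i → ∑.sum (f i))           ≡⟨ ∑.∑-comm f ⟩
  ∑.sum (λ j → ∑.sum (λ i → f i j))   ≡⟨ Σ<≡sum n _ ⟨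
  Σ< n (λ j → ∑.sum (λ i → f i j))    ≡⟨ Σ<-cong n (λ j → Σ<≡sum m (λ i → f i j)) ⟨
  Σ< n (λ j → Σ< m (λ i → f i j))     ∎
  where open ≡-Reasoning

Σ<-permute : ∀ {m n} (f : Fin n → ℕ) (π : Permutation m n) →
             Σ< n f ≡ Σ< m (λ i → f (π ⟨$⟩ʳ i))
Σ<-permute {m} {n} f π =
  trans (Σ<≡sum n f) (trans (∑.∑-permute f π) (sym (Σ<≡sum m _)))

Σ<-↑ : ∀ a b (f : Fin (a + b) → ℕ) →
       Σ< (a + b) f ≡ Σ< a (λ i → f (i ↑ˡ b)) + Σ< b (λ j → f (a ↑ʳ j))
Σ<-↑ zero    b f = refl
Σ<-↑ (suc a) b f = trans (cong (f fz +_) (Σ<-↑ a b (f ∘ fs))) (sym (+-assoc (f fz) _ _))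

Σ<-single : ∀ n (f : Fin n → ℕ) i → (∀ j → j ≢ i → f j ≡ 0) → Σ< n f ≡ f i
Σ<-single (suc n) f fz e =
  trans (cong (f fz +_) (Σ<-zero n (λ j → e (fs j) (λ ())))) (+-identityʳ _)
Σ<-single (suc n) f (fs i) e = begin
  f fz + Σ< n (f ∘ fs) ≡⟨ cong (_+ Σ< n (f ∘ fs)) (e fz (λ ())) ⟩
  Σ< n (f ∘ fs)        ≡⟨ Σ<-single n (f ∘ fs) i (λ j j≢i → e (fs j) (j≢i ∘ FP.suc-injective)) ⟩
  f (fs i)             ∎
  where open ≡-Reasoning

term≤Σ< : ∀ n (f : Fin n → ℕ) i → f i ≤ Σ< n f
term≤Σ< (suc n) f fz     = m≤m+n _ _
term≤Σ< (suc n) f (fs i) = ≤-trans (term≤Σ< n (f ∘ fs) i) (m≤n+m _ _)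

twoTerms≤Σ< : ∀ n (f : Fin n → ℕ) i j → i ≢ j → f i + f j ≤ Σ< n f
twoTerms≤Σ< (suc n) f fz     fz     i≢j = ⊥-elim (i≢j refl)
twoTerms≤Σ< (suc n) f fz     (fs j) _   = +-monoʳ-≤ (f fz) (term≤Σ< n (f ∘ fs) j)
twoTerms≤Σ< (suc n) f (fs i) fz     _   =
  subst (_≤ Σ< (suc n) f) (+-comm (f fz) (f (fs i))) (+-monoʳ-≤ (f fz) (term≤Σ< n (f ∘ fs) i))
twoTerms≤Σ< (suc n) f (fs i) (fs j) i≢j =
  ≤-trans (twoTerms≤Σ< n (f ∘ fs) i j (i≢j ∘ cong fs)) (m≤n+m _ _)

Σ<-positive : ∀ n (f : Fin n → ℕ) → 1 ≤ Σ< n f → ∃ λ i → 1 ≤ f i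
Σ<-positive (suc n) f h with f fz in eq
... | suc _ = fz , subst (1 ≤_) (sym eq) (s≤s z≤n)
... | zero  with Σ<-positive n (f ∘ fs) h
...   | i , p = fs i , p

*-positive⁻¹ : ∀ m n → 1 ≤ m * n → 1 ≤ m × 1 ≤ n
*-positive⁻¹ (suc m) (suc n) _ = s≤s z≤n , s≤s z≤n
*-positive⁻¹ (suc m) zero    h = ⊥-elim (<-irrefl (sym (*-zeroʳ m)) h)

Σ<-exceeds : ∀ n (f : Fin n → ℕ) {i j v} → i ≢ j → 1 ≤ f i → v ≤ f j → v < Σ< n f
Σ<-exceeds n f {i} {j} i≢j 1≤fi v≤fj = ≤-trans (+-mono-≤ 1≤fi v≤fj) (twoTerms≤Σ< n f i j i≢j)

fold-preserves : ∀ {X : Set} (P : X → Set) {f : X → X} → (∀ {x} → P x → P (f x)) →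
                 ∀ {x} → P x → ∀ j → P (fold x f j)
fold-preserves P P-f Px zero    = Px
fold-preserves P P-f Px (suc j) = P-f (fold-preserves P P-f Px j)

fold-shift : ∀ {X : Set} (f : X → X) x j → fold (f x) f j ≡ fold x f (suc j)
fold-shift f x zero    = refl
fold-shift f x (suc j) = cong f (fold-shift f x j)

module PeriodicPoint {X : Set} (f : X → X) {x : X} {p : ℕ} (fold-period : fold x f (suc p) ≡ x) where

  fold-*period : ∀ q → fold x f (q * suc p) ≡ x
  fold-*period zero    = refl
  fold-*period (suc q) =
    trans (fold-+ x f (suc p)) (trans (cong (λ y → fold y f (suc p)) (fold-*period q)) fold-period)

  fold-% : ∀ j → fold x f j ≡ fold x f (j % suc p)
  fold-% j = begin
    fold x f j                                       ≡⟨ cong (fold x f) (m≡m%n+[m/n]*n j (suc p)) ⟩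
    fold x f (j % suc p + j / suc p * suc p)         ≡⟨ fold-+ x f (j % suc p) ⟩
    fold (fold x f (j / suc p * suc p)) f (j % suc p) ≡⟨ cong (λ y → fold y f (j % suc p)) (fold-*period (j / suc p)) ⟩
    fold x f (j % suc p)                             ∎
    where open ≡-Reasoning

  period-∣ : (∀ r → r < p → fold x f (suc r) ≢ x) → ∀ D → fold x f D ≡ x → suc p ∣ D
  period-∣ minimal D fold-D with D % suc p in eq
  ... | zero  = m%n≡0⇒n∣m D (suc p) eq
  ... | suc r = ⊥-elim (minimal r (s≤s⁻¹ (subst (_< suc p) eq (m%n<n D (suc p))))
                  (trans (cong (fold x f) (sym eq)) (trans (sym (fold-% D)) fold-D)))

-- Matrix algebra

≈M-refl : ∀ {m n} {A : Mat m n} → A ≈M A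
≈M-refl _ _ = refl

≈M-sym : ∀ {m n} {A B : Mat m n} → A ≈M B → B ≈M A
≈M-sym e i j = sym (e i j)

≈M-trans : ∀ {m n} {A B C : Mat m n} → A ≈M B → B ≈M C → A ≈M C
≈M-trans e f i j = trans (e i j) (f i j)

⊗-cong : ∀ {m n p} {A A′ : Mat m n} {B B′ : Mat n p} → A ≈M A′ → B ≈M B′ → (A ⊗ B) ≈M (A′ ⊗ B′)
⊗-cong {n = n} eA eB i j = Σ<-cong n (λ l → cong₂ _*_ (eA i l) (eB l j))

⊗-assoc : ∀ {m n p q} (A : Mat m n) (B : Mat n p) (C : Mat p q) → ((A ⊗ B) ⊗ C) ≈M (A ⊗ (B ⊗ C))
⊗-assoc {n = n} {p = p} A B C i j = begin
  Σ< p (λ l → Σ< n (λ m → A i m * B m l) * C l j)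
    ≡⟨ Σ<-cong p (λ l → sym (Σ<-*ʳ n (C l j) (λ m → A i m * B m l))) ⟩
  Σ< p (λ l → Σ< n (λ m → A i m * B m l * C l j))
    ≡⟨ Σ<-comm p n _ ⟩
  Σ< n (λ m → Σ< p (λ l → A i m * B m l * C l j))
    ≡⟨ Σ<-cong n (λ m → trans (Σ<-cong p (λ l → *-assoc (A i m) (B m l) (C l j))) (Σ<-*ˡ p (A i m) _)) ⟩
  Σ< n (λ m → A i m * Σ< p (λ l → B m l * C l j)) ∎
  where open ≡-Reasoning

idM-refl : ∀ {n} (i : Fin n) → idM i i ≡ 1
idM-refl i with i FP.≟ i
... | yes _  = refl
... | no i≢i = ⊥-elim (i≢i refl)

idM-≢ : ∀ {n} {i j : Fin n} → i ≢ j → idM i j ≡ 0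
idM-≢ {i = i} {j} i≢j with i FP.≟ j
... | yes i≡j = ⊥-elim (i≢j i≡j)
... | no _    = refl

idM-cong : ∀ {m n} {i j : Fin m} {i′ j′ : Fin n} →
           (i ≡ j → i′ ≡ j′) → (i′ ≡ j′ → i ≡ j) → idM i j ≡ idM i′ j′
idM-cong {i = i} {j} {i′} {j′} to from with i FP.≟ j | i′ FP.≟ j′
... | yes _   | yes _    = refl
... | yes i≡j | no i′≢j′ = ⊥-elim (i′≢j′ (to i≡j))
... | no i≢j  | yes i′≡j′ = ⊥-elim (i≢j (from i′≡j′))
... | no _    | no _     = refl

idM-sym : ∀ {n} (i j : Fin n) → idM i j ≡ idM j i
idM-sym i j = idM-cong sym sym

Σ<-idMˡ : ∀ n (g : Fin n → ℕ) i → Σ< n (λ l → idM i l * g l) ≡ g i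
Σ<-idMˡ n g i = begin
  Σ< n (λ l → idM i l * g l) ≡⟨ Σ<-single n _ i (λ l l≢i → cong (_* g l) (idM-≢ (l≢i ∘ sym))) ⟩
  idM i i * g i              ≡⟨ cong (_* g i) (idM-refl i) ⟩
  1 * g i                    ≡⟨ *-identityˡ (g i) ⟩
  g i                        ∎
  where open ≡-Reasoning

Σ<-idMʳ : ∀ n (g : Fin n → ℕ) i → Σ< n (λ l → g l * idM i l) ≡ g i
Σ<-idMʳ n g i = trans (Σ<-cong n (λ l → *-comm (g l) (idM i l))) (Σ<-idMˡ n g i)

⊗-identityˡ : ∀ {m n} (B : Mat m n) → (idM ⊗ B) ≈M B
⊗-identityˡ {m} B i j = Σ<-idMˡ m (λ l → B l j) i

⊗-identityʳ : ∀ {m n} (B : Mat m n) → (B ⊗ idM) ≈M B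
⊗-identityʳ {n = n} B i j =
  trans (Σ<-cong n (λ l → cong (B i l *_) (idM-sym l j))) (Σ<-idMʳ n (B i) j)

^^-cong : ∀ {n} (A : Mat n n) {a b} → a ≡ b → (A ^^ a) ≈M (A ^^ b)
^^-cong A refl = ≈M-refl

^^-1 : ∀ {n} (A : Mat n n) → (A ^^ 1) ≈M A
^^-1 = ⊗-identityʳ

^^-+ : ∀ {n} (A : Mat n n) a b → (A ^^ (a + b)) ≈M ((A ^^ a) ⊗ (A ^^ b))
^^-+ A zero    b = ≈M-sym (⊗-identityˡ (A ^^ b))
^^-+ A (suc a) b = ≈M-trans (⊗-cong (≈M-refl {A = A}) (^^-+ A a b)) (≈M-sym (⊗-assoc A (A ^^ a) (A ^^ b)))

permMat-idM : ∀ {n m} (π : Permutation n m) i j → permMat π i j ≡ idM (π ⟨$⟩ʳ i) j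
permMat-idM π i j with (π ⟨$⟩ʳ i) FP.≟ j
... | yes _ = refl
... | no  _ = refl

idM-permute : ∀ {n m} (π : Permutation n m) i j → idM (π ⟨$⟩ʳ i) j ≡ idM (π ⟨$⟩ˡ j) i
idM-permute π i j =
  idM-cong (λ πi≡j → trans (cong (π ⟨$⟩ˡ_) (sym πi≡j)) (inverseˡ π))
           (λ π⁻j≡i → trans (cong (π ⟨$⟩ʳ_) (sym π⁻j≡i)) (inverseʳ π))

permMat-conj : ∀ {n m} (π : Permutation n m) (A : Mat n n) i j →
               ((permMat π ᵀ) ⊗ A ⊗ permMat π) i j ≡ A (π ⟨$⟩ˡ i) (π ⟨$⟩ˡ j)
permMat-conj {n} π A i j = begin
  Σ< n (λ l → ((permMat π ᵀ) ⊗ A) i l * permMat π l j)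
    ≡⟨ Σ<-cong n (λ l → cong₂ _*_ (row l) (trans (permMat-idM π l j) (idM-permute π l j))) ⟩
  Σ< n (λ l → A (π ⟨$⟩ˡ i) l * idM (π ⟨$⟩ˡ j) l)
    ≡⟨ Σ<-idMʳ n (A (π ⟨$⟩ˡ i)) (π ⟨$⟩ˡ j) ⟩
  A (π ⟨$⟩ˡ i) (π ⟨$⟩ˡ j) ∎
  where
  open ≡-Reasoning
  row : ∀ l → ((permMat π ᵀ) ⊗ A) i l ≡ A (π ⟨$⟩ˡ i) l
  row l = trans (Σ<-cong n (λ x → cong (_* A x l) (trans (permMat-idM π x i) (idM-permute π x i))))
                (Σ<-idMˡ n (λ x → A x l) (π ⟨$⟩ˡ i))

^^-relabel : ∀ {n m} (π : Permutation n m) (A : Mat n n) (B : Mat m m) →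
             (∀ x y → A x y ≡ B (π ⟨$⟩ʳ x) (π ⟨$⟩ʳ y)) →
             ∀ j x y → (A ^^ j) x y ≡ (B ^^ j) (π ⟨$⟩ʳ x) (π ⟨$⟩ʳ y)
^^-relabel π A B A≡B zero x y =
  idM-cong (cong (π ⟨$⟩ʳ_)) (λ πx≡πy → trans (sym (inverseˡ π)) (trans (cong (π ⟨$⟩ˡ_) πx≡πy) (inverseˡ π)))
^^-relabel {n} π A B A≡B (suc j) x y = begin
  Σ< n (λ l → A x l * (A ^^ j) l y)
    ≡⟨ Σ<-cong n (λ l → cong₂ _*_ (A≡B x l) (^^-relabel π A B A≡B j l y)) ⟩
  Σ< n (λ l → B (π ⟨$⟩ʳ x) (π ⟨$⟩ʳ l) * (B ^^ j) (π ⟨$⟩ʳ l) (π ⟨$⟩ʳ y))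
    ≡⟨ Σ<-permute (λ l → B (π ⟨$⟩ʳ x) l * (B ^^ j) l (π ⟨$⟩ʳ y)) π ⟨
  (B ^^ suc j) (π ⟨$⟩ʳ x) (π ⟨$⟩ʳ y) ∎
  where open ≡-Reasoning

PermSimilar-^^ : ∀ {n m} {A : Mat n n} {B : Mat m m} → PermSimilar A B →
                 ∀ k → (B ^^ k) ≈M B → (A ^^ k) ≈M A
PermSimilar-^^ {A = A} {B} (π , B≈QᵀAQ) k Bᵏ≈B x y = begin
  (A ^^ k) x y                    ≡⟨ ^^-relabel π A B A≡B k x y ⟩
  (B ^^ k) (π ⟨$⟩ʳ x) (π ⟨$⟩ʳ y)  ≡⟨ Bᵏ≈B _ _ ⟩
  B (π ⟨$⟩ʳ x) (π ⟨$⟩ʳ y)         ≡⟨ A≡B x y ⟨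
  A x y                           ∎
  where
  open ≡-Reasoning
  A≡B : ∀ x y → A x y ≡ B (π ⟨$⟩ʳ x) (π ⟨$⟩ʳ y)
  A≡B x y = sym (trans (B≈QᵀAQ _ _) (trans (permMat-conj π A _ _) (cong₂ A (inverseˡ π) (inverseˡ π))))

-- Enumerating decidable subsets of Fin n

data SplitView (m n : ℕ) : Fin (m + n) → Set where
  left  : ∀ i → SplitView m n (i ↑ˡ n)
  right : ∀ j → SplitView m n (m ↑ʳ j)

splitView : ∀ m n i → SplitView m n i
splitView m n i with splitAt m i in eq
... | inj₁ x = subst (SplitView m n) (FP.splitAt⁻¹-↑ˡ eq) (left x)
... | inj₂ y = subst (SplitView m n) (FP.splitAt⁻¹-↑ʳ eq) (right y)

↑ˡ≢↑ʳ : ∀ {m n} (i : Fin m) (j : Fin n) → i ↑ˡ n ≢ m ↑ʳ j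
↑ˡ≢↑ʳ {m} {n} i j eq with trans (sym (FP.splitAt-↑ˡ m i n)) (trans (cong (splitAt m) eq) (FP.splitAt-↑ʳ m n j))
... | ()

record Enumeration {n} (P : Fin n → Set) (size : ℕ) : Set where
  field
    elem            : Fin size → Fin n
    elem-injective  : ∀ {i j} → elem i ≡ elem j → i ≡ j
    elem-∈          : ∀ i → P (elem i)
    elem-surjective : ∀ {y} → P y → ∃ λ i → elem i ≡ y

enumerate : ∀ {n} {P : Fin n → Set} → (∀ y → Dec (P y)) → ∃ (Enumeration P)
enumerate {zero} P? = 0 , record
  { elem = λ () ; elem-injective = λ { {()} } ; elem-∈ = λ () ; elem-surjective = λ { {()} } }
enumerate {suc n} {P} P? with enumerate (P? ∘ fs) | P? fz
... | s , e | no ¬P0 = s , record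
  { elem            = fs ∘ elem
  ; elem-injective  = elem-injective ∘ FP.suc-injective
  ; elem-∈          = elem-∈
  ; elem-surjective = λ { {fz} P0 → ⊥-elim (¬P0 P0) ; {fs y} Py → map₂ (cong fs) (elem-surjective Py) }
  }
  where open Enumeration e
... | s , e | yes P0 = suc s , record
  { elem            = elem′
  ; elem-injective  = injective
  ; elem-∈          = λ { fz → P0 ; (fs i) → elem-∈ i }
  ; elem-surjective = λ { {fz} _ → fz , refl ; {fs y} Py → map fs (cong fs) (elem-surjective Py) }
  }
  where
  open Enumeration e
  elem′ : Fin (suc s) → Fin (suc n)
  elem′ fz     = fz
  elem′ (fs i) = fs (elem i)
  injective : ∀ {i j} → elem′ i ≡ elem′ j → i ≡ j
  injective {fz}   {fz}   _  = refl
  injective {fs i} {fs j} eq = cong fs (elem-injective (FP.suc-injective eq))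
  injective {fz}   {fs _} ()
  injective {fs _} {fz}   ()

Enumeration-⇔ : ∀ {n s} {P Q : Fin n → Set} → (∀ {y} → P y → Q y) → (∀ {y} → Q y → P y) →
                Enumeration P s → Enumeration Q s
Enumeration-⇔ P⇒Q Q⇒P e = record
  { elem = elem ; elem-injective = elem-injective ; elem-∈ = P⇒Q ∘ elem-∈ ; elem-surjective = elem-surjective ∘ Q⇒P }
  where open Enumeration e

Enumeration-++ : ∀ {n a b} {P Q : Fin n → Set} → (∀ {y} → P y → ¬ Q y) →
                 Enumeration P a → Enumeration Q b → Enumeration (λ y → P y ⊎ Q y) (a + b)
Enumeration-++ {a = a} {b} {P} {Q} disjoint e₁ e₂ = record
  { elem = elem ; elem-injective = injective _ _ ; elem-∈ = ∈ ; elem-surjective = surjective }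
  where
  module E₁ = Enumeration e₁
  module E₂ = Enumeration e₂
  elem : Fin (a + b) → _
  elem = E₁.elem ++ E₂.elem
  ∈ : ∀ i → P (elem i) ⊎ Q (elem i)
  ∈ i with splitView a b i
  ... | left  i₁ = inj₁ (subst P (sym (lookup-++ˡ E₁.elem E₂.elem i₁)) (E₁.elem-∈ i₁))
  ... | right i₂ = inj₂ (subst Q (sym (lookup-++ʳ E₁.elem E₂.elem i₂)) (E₂.elem-∈ i₂))
  injective : ∀ i j → elem i ≡ elem j → i ≡ j
  injective i j eq with splitView a b i | splitView a b j
  ... | left i₁  | left j₁  = cong (_↑ˡ b) (E₁.elem-injective
        (trans (sym (lookup-++ˡ E₁.elem E₂.elem i₁)) (trans eq (lookup-++ˡ E₁.elem E₂.elem j₁))))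
  ... | right i₂ | right j₂ = cong (a ↑ʳ_) (E₂.elem-injective
        (trans (sym (lookup-++ʳ E₁.elem E₂.elem i₂)) (trans eq (lookup-++ʳ E₁.elem E₂.elem j₂))))
  ... | left i₁  | right j₂ = ⊥-elim (disjoint (E₁.elem-∈ i₁) (subst Q
        (sym (trans (sym (lookup-++ˡ E₁.elem E₂.elem i₁)) (trans eq (lookup-++ʳ E₁.elem E₂.elem j₂)))) (E₂.elem-∈ j₂)))
  ... | right i₂ | left j₁  = ⊥-elim (disjoint (E₁.elem-∈ j₁) (subst Q
        (sym (trans (sym (lookup-++ˡ E₁.elem E₂.elem j₁)) (trans (sym eq) (lookup-++ʳ E₁.elem E₂.elem i₂)))) (E₂.elem-∈ i₂)))
  surjective : ∀ {y} → P y ⊎ Q y → ∃ λ i → elem i ≡ y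
  surjective (inj₁ Py) with E₁.elem-surjective Py
  ... | i , eq = i ↑ˡ b , trans (lookup-++ˡ E₁.elem E₂.elem i) eq
  surjective (inj₂ Qy) with E₂.elem-surjective Qy
  ... | i , eq = a ↑ʳ i , trans (lookup-++ʳ E₁.elem E₂.elem i) eq

Enumeration-permutation : ∀ {n s} {P : Fin n → Set} → (∀ y → P y) → Enumeration P s → Permutation n s
Enumeration-permutation all e = permutation index elem
  (λ i → elem-injective (proj₂ (elem-surjective (all (elem i)))))
  (λ y → proj₂ (elem-surjective (all y)))
  where
  open Enumeration e
  index : _ → _
  index y = proj₁ (elem-surjective (all y))

-- Basic circulants

circSucc : ∀ m → Fin m → Fin m
circSucc (suc m) i = fromℕ< (m%n<n (suc (toℕ i)) (suc m))

toℕ-circSucc : ∀ m (i : Fin (suc m)) → toℕ (circSucc (suc m) i) ≡ suc (toℕ i) % suc m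
toℕ-circSucc m i = FP.toℕ-fromℕ< _

circ-idM : ∀ m (i j : Fin m) → circ m i j ≡ idM (circSucc m i) j
circ-idM (suc m) i j with toℕ j ≟ suc (toℕ i) % suc m | circSucc (suc m) i FP.≟ j
... | yes _ | yes _ = refl
... | yes j≡ | no ≢j = ⊥-elim (≢j (FP.toℕ-injective (trans (toℕ-circSucc m i) (sym j≡))))
... | no j≢ | yes ≡j = ⊥-elim (j≢ (trans (cong toℕ (sym ≡j)) (toℕ-circSucc m i)))
... | no _  | no _  = refl

suc[m%n]%n≡suc[m]%n : ∀ m n .{{_ : NonZero n}} → suc (m % n) % n ≡ suc m % n
suc[m%n]%n≡suc[m]%n m n = begin
  (1 + m % n) % n            ≡⟨ %-distribˡ-+ 1 (m % n) n ⟩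
  (1 % n + m % n % n) % n    ≡⟨ cong (λ k → (1 % n + k) % n) (m%n%n≡m%n m n) ⟩
  (1 % n + m % n) % n        ≡⟨ %-distribˡ-+ 1 m n ⟨
  (1 + m) % n                ∎
  where open ≡-Reasoning

toℕ-fold-circSucc : ∀ m (i : Fin (suc m)) j → toℕ (fold i (circSucc (suc m)) j) ≡ (toℕ i + j) % suc m
toℕ-fold-circSucc m i zero = sym (trans (cong (_% suc m) (+-identityʳ (toℕ i))) (m<n⇒m%n≡m (FP.toℕ<n i)))
toℕ-fold-circSucc m i (suc j) = begin
  toℕ (circSucc (suc m) (fold i (circSucc (suc m)) j)) ≡⟨ toℕ-circSucc m _ ⟩
  suc (toℕ (fold i (circSucc (suc m)) j)) % suc m      ≡⟨ cong (λ k → suc k % suc m) (toℕ-fold-circSucc m i j) ⟩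
  suc ((toℕ i + j) % suc m) % suc m                    ≡⟨ suc[m%n]%n≡suc[m]%n (toℕ i + j) (suc m) ⟩
  suc (toℕ i + j) % suc m                              ≡⟨ cong (_% suc m) (+-suc (toℕ i) j) ⟨
  (toℕ i + suc j) % suc m                              ∎
  where open ≡-Reasoning

fold-circSucc-period : ∀ m D → m ∣ D → (i : Fin m) → fold i (circSucc m) D ≡ i
fold-circSucc-period (suc m) D m∣D i = FP.toℕ-injective (begin
  toℕ (fold i (circSucc (suc m)) D) ≡⟨ toℕ-fold-circSucc m i D ⟩
  (toℕ i + D) % suc m               ≡⟨ %-remove-+ʳ (toℕ i) m∣D ⟩
  toℕ i % suc m                     ≡⟨ m<n⇒m%n≡m (FP.toℕ<n i) ⟩
  toℕ i                             ∎)
  where open ≡-Reasoning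

circSumSucc : (ns : List ℕ) → Fin (sum ns) → Fin (sum ns)
circSumSucc []       ()
circSumSucc (m ∷ ns) = (λ i → circSucc m i ↑ˡ sum ns) ++ (λ j → m ↑ʳ circSumSucc ns j)

circSumSucc-↑ˡ : ∀ m ns (i : Fin m) → circSumSucc (m ∷ ns) (i ↑ˡ sum ns) ≡ circSucc m i ↑ˡ sum ns
circSumSucc-↑ˡ m ns = lookup-++ˡ _ (λ j → m ↑ʳ circSumSucc ns j)

circSumSucc-↑ʳ : ∀ m ns (j : Fin (sum ns)) → circSumSucc (m ∷ ns) (m ↑ʳ j) ≡ m ↑ʳ circSumSucc ns j
circSumSucc-↑ʳ m ns = lookup-++ʳ (λ i → circSucc m i ↑ˡ sum ns) _

circSum-idM : ∀ ns (i j : Fin (sum ns)) → circSum ns i j ≡ idM (circSumSucc ns i) j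
circSum-idM []       ()
circSum-idM (m ∷ ns) i j with splitView m (sum ns) i | splitView m (sum ns) j
... | left x  | left y  rewrite FP.splitAt-↑ˡ m x (sum ns) | FP.splitAt-↑ˡ m y (sum ns) =
  trans (circ-idM m x y) (idM-cong (cong (_↑ˡ sum ns)) (FP.↑ˡ-injective (sum ns) _ _))
... | left x  | right y rewrite FP.splitAt-↑ˡ m x (sum ns) | FP.splitAt-↑ʳ m (sum ns) y =
  sym (idM-≢ (↑ˡ≢↑ʳ (circSucc m x) y))
... | right x | left y  rewrite FP.splitAt-↑ʳ m (sum ns) x | FP.splitAt-↑ˡ m y (sum ns) =
  sym (idM-≢ (↑ˡ≢↑ʳ y (circSumSucc ns x) ∘ sym))
... | right x | right y rewrite FP.splitAt-↑ʳ m (sum ns) x | FP.splitAt-↑ʳ m (sum ns) y =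
  trans (circSum-idM ns x y) (idM-cong (cong (m ↑ʳ_)) (FP.↑ʳ-injective m _ _))

fold-circSumSucc-↑ˡ : ∀ m ns (i : Fin m) j →
  fold (i ↑ˡ sum ns) (circSumSucc (m ∷ ns)) j ≡ fold i (circSucc m) j ↑ˡ sum ns
fold-circSumSucc-↑ˡ m ns i zero    = refl
fold-circSumSucc-↑ˡ m ns i (suc j) =
  trans (cong (circSumSucc (m ∷ ns)) (fold-circSumSucc-↑ˡ m ns i j)) (circSumSucc-↑ˡ m ns _)

fold-circSumSucc-↑ʳ : ∀ m ns (i : Fin (sum ns)) j →
  fold (m ↑ʳ i) (circSumSucc (m ∷ ns)) j ≡ m ↑ʳ fold i (circSumSucc ns) j
fold-circSumSucc-↑ʳ m ns i zero    = refl
fold-circSumSucc-↑ʳ m ns i (suc j) =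
  trans (cong (circSumSucc (m ∷ ns)) (fold-circSumSucc-↑ʳ m ns i j)) (circSumSucc-↑ʳ m ns _)

fold-circSumSucc-period : ∀ D ns → All (_∣ D) ns → (i : Fin (sum ns)) → fold i (circSumSucc ns) D ≡ i
fold-circSumSucc-period D []       []           ()
fold-circSumSucc-period D (m ∷ ns) (m∣D ∷ ns∣D) i with splitView m (sum ns) i
... | left x  = trans (fold-circSumSucc-↑ˡ m ns x D) (cong (_↑ˡ sum ns) (fold-circSucc-period m D m∣D x))
... | right y = trans (fold-circSumSucc-↑ʳ m ns y D) (cong (m ↑ʳ_) (fold-circSumSucc-period D ns ns∣D y))

circSumSucc-permutation : ∀ D ns → All (_∣ suc D) ns → Permutation (sum ns) (sum ns)
circSumSucc-permutation D ns ns∣D = permutation (circSumSucc ns) (λ i → fold i (circSumSucc ns) D)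
  (fold-circSumSucc-period (suc D) ns ns∣D)
  (λ i → trans (fold-shift (circSumSucc ns) i D) (fold-circSumSucc-period (suc D) ns ns∣D i))

Σ<-circSumSucc : ∀ D ns → All (_∣ suc D) ns → (g : Fin (sum ns) → ℕ) →
                 Σ< (sum ns) g ≡ Σ< (sum ns) (g ∘ circSumSucc ns)
Σ<-circSumSucc D ns ns∣D g = Σ<-permute g (circSumSucc-permutation D ns ns∣D)

-- Block matrices

module Block3 {a b c : ℕ}
  (A₁₁ : Mat a a) (A₁₂ : Mat a b) (A₁₃ : Mat a c)
  (A₂₁ : Mat b a) (A₂₂ : Mat b b) (A₂₃ : Mat b c)
  (A₃₁ : Mat c a) (A₃₂ : Mat c b) (A₃₃ : Mat c c) where

  B : Mat (a + (b + c)) (a + (b + c))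
  B = block3 {a} {b} {c} A₁₁ A₁₂ A₁₃ A₂₁ A₂₂ A₂₃ A₃₁ A₃₂ A₃₃

  ι₁ : Fin a → Fin (a + (b + c))
  ι₁ i = i ↑ˡ (b + c)
  ι₂ : Fin b → Fin (a + (b + c))
  ι₂ i = a ↑ʳ (i ↑ˡ c)
  ι₃ : Fin c → Fin (a + (b + c))
  ι₃ i = a ↑ʳ (b ↑ʳ i)

  data View : Fin (a + (b + c)) → Set where
    in₁ : ∀ i → View (ι₁ i)
    in₂ : ∀ i → View (ι₂ i)
    in₃ : ∀ i → View (ι₃ i)

  view : ∀ i → View i
  view i with splitView a (b + c) i
  ... | left i₁ = in₁ i₁
  ... | right r with splitView b c r
  ...   | left i₂  = in₂ i₂
  ...   | right i₃ = in₃ i₃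

  B₁₁ : ∀ i j → B (ι₁ i) (ι₁ j) ≡ A₁₁ i j
  B₁₁ i j rewrite FP.splitAt-↑ˡ a i (b + c) | FP.splitAt-↑ˡ a j (b + c) = refl
  B₁₂ : ∀ i j → B (ι₁ i) (ι₂ j) ≡ A₁₂ i j
  B₁₂ i j rewrite FP.splitAt-↑ˡ a i (b + c) | FP.splitAt-↑ʳ a (b + c) (j ↑ˡ c) | FP.splitAt-↑ˡ b j c = refl
  B₁₃ : ∀ i j → B (ι₁ i) (ι₃ j) ≡ A₁₃ i j
  B₁₃ i j rewrite FP.splitAt-↑ˡ a i (b + c) | FP.splitAt-↑ʳ a (b + c) (b ↑ʳ j) | FP.splitAt-↑ʳ b c j = refl
  B₂₁ : ∀ i j → B (ι₂ i) (ι₁ j) ≡ A₂₁ i j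
  B₂₁ i j rewrite FP.splitAt-↑ʳ a (b + c) (i ↑ˡ c) | FP.splitAt-↑ˡ a j (b + c) | FP.splitAt-↑ˡ b i c = refl
  B₂₂ : ∀ i j → B (ι₂ i) (ι₂ j) ≡ A₂₂ i j
  B₂₂ i j rewrite FP.splitAt-↑ʳ a (b + c) (i ↑ˡ c) | FP.splitAt-↑ʳ a (b + c) (j ↑ˡ c) | FP.splitAt-↑ˡ b i c | FP.splitAt-↑ˡ b j c = refl
  B₂₃ : ∀ i j → B (ι₂ i) (ι₃ j) ≡ A₂₃ i j
  B₂₃ i j rewrite FP.splitAt-↑ʳ a (b + c) (i ↑ˡ c) | FP.splitAt-↑ʳ a (b + c) (b ↑ʳ j) | FP.splitAt-↑ˡ b i c | FP.splitAt-↑ʳ b c j = refl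
  B₃₁ : ∀ i j → B (ι₃ i) (ι₁ j) ≡ A₃₁ i j
  B₃₁ i j rewrite FP.splitAt-↑ʳ a (b + c) (b ↑ʳ i) | FP.splitAt-↑ˡ a j (b + c) | FP.splitAt-↑ʳ b c i = refl
  B₃₂ : ∀ i j → B (ι₃ i) (ι₂ j) ≡ A₃₂ i j
  B₃₂ i j rewrite FP.splitAt-↑ʳ a (b + c) (b ↑ʳ i) | FP.splitAt-↑ʳ a (b + c) (j ↑ˡ c) | FP.splitAt-↑ʳ b c i | FP.splitAt-↑ˡ b j c = refl
  B₃₃ : ∀ i j → B (ι₃ i) (ι₃ j) ≡ A₃₃ i j
  B₃₃ i j rewrite FP.splitAt-↑ʳ a (b + c) (b ↑ʳ i) | FP.splitAt-↑ʳ a (b + c) (b ↑ʳ j) | FP.splitAt-↑ʳ b c i | FP.splitAt-↑ʳ b c j = refl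

  Σ<-view : (g : Fin (a + (b + c)) → ℕ) →
            Σ< (a + (b + c)) g ≡ Σ< a (g ∘ ι₁) + (Σ< b (g ∘ ι₂) + Σ< c (g ∘ ι₃))
  Σ<-view g = trans (Σ<-↑ a (b + c) g) (cong (Σ< a (g ∘ ι₁) +_) (Σ<-↑ b c (λ r → g (a ↑ʳ r))))

⊗-circSumᵀ : ∀ {a} ns (X : Mat a (sum ns)) i j → (X ⊗ (circSum ns ᵀ)) i j ≡ X i (circSumSucc ns j)
⊗-circSumᵀ ns X i j =
  trans (Σ<-cong (sum ns) (λ l → cong (X i l *_) (circSum-idM ns j l))) (Σ<-idMʳ (sum ns) (X i) (circSumSucc ns j))

module CanonicalForm (d a c : ℕ) (ns : List ℕ) (ns∣ : All (λ m → 1 ≤ m × m ∣ suc d) ns)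
  (X : Mat a (sum ns)) (Y : Mat (sum ns) c) where

  s : ℕ
  s = sum ns

  S : Fin s → Fin s
  S = circSumSucc ns

  open Block3 {a} {s} {c} zeroM X (X ⊗ (circSum ns ᵀ) ⊗ Y) zeroM (circSum ns) Y zeroM zeroM zeroM public

  row₃-zero : ∀ t x → B (ι₃ t) x ≡ 0
  row₃-zero t x with view x
  ... | in₁ i = B₃₁ t i
  ... | in₂ i = B₃₂ t i
  ... | in₃ i = B₃₃ t i

  col₁-zero : ∀ x f → B x (ι₁ f) ≡ 0
  col₁-zero x f with view x
  ... | in₁ i = B₁₁ i f
  ... | in₂ i = B₂₁ i f
  ... | in₃ i = B₃₁ i f

  ^^-row₃ : ∀ j t x → (B ^^ suc j) (ι₃ t) x ≡ 0
  ^^-row₃ j t x = Σ<-zero (a + (s + c)) (λ y → cong (_* (B ^^ j) y x) (row₃-zero t y))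

  -- Paths of length ≥ 2 avoid the first block column and the last block row, which vanish in B.
  ^^-step : ∀ j i x → (B ^^ suc (suc j)) i x ≡ Σ< s (λ m → B i (ι₂ m) * (B ^^ suc j) (ι₂ m) x)
  ^^-step j i x = begin
    (B ^^ suc (suc j)) i x
      ≡⟨ Σ<-view (λ y → B i y * (B ^^ suc j) y x) ⟩
    Σ< a (λ f → B i (ι₁ f) * (B ^^ suc j) (ι₁ f) x) +
      (Σ< s (λ m → B i (ι₂ m) * (B ^^ suc j) (ι₂ m) x) + Σ< c (λ t → B i (ι₃ t) * (B ^^ suc j) (ι₃ t) x))
      ≡⟨ cong₂ (λ u v → u + (Σ< s (λ m → B i (ι₂ m) * (B ^^ suc j) (ι₂ m) x) + v))
           (Σ<-zero a (λ f → cong (_* (B ^^ suc j) (ι₁ f) x) (col₁-zero i f)))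
           (Σ<-zero c (λ t → trans (cong (B i (ι₃ t) *_) (^^-row₃ j t x)) (*-zeroʳ (B i (ι₃ t))))) ⟩
    Σ< s (λ m → B i (ι₂ m) * (B ^^ suc j) (ι₂ m) x) + 0
      ≡⟨ +-identityʳ _ ⟩
    Σ< s (λ m → B i (ι₂ m) * (B ^^ suc j) (ι₂ m) x) ∎
    where open ≡-Reasoning

  ^^-row₂ : ∀ j m x → (B ^^ suc j) (ι₂ m) x ≡ B (ι₂ (fold m S j)) x
  ^^-row₂ zero    m x = ^^-1 B (ι₂ m) x
  ^^-row₂ (suc j) m x = begin
    (B ^^ suc (suc j)) (ι₂ m) x                             ≡⟨ ^^-step j (ι₂ m) x ⟩
    Σ< s (λ m′ → B (ι₂ m) (ι₂ m′) * (B ^^ suc j) (ι₂ m′) x) ≡⟨ Σ<-cong s (λ m′ → cong (_* (B ^^ suc j) (ι₂ m′) x)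
                                                                  (trans (B₂₂ m m′) (circSum-idM ns m m′))) ⟩
    Σ< s (λ m′ → idM (S m) m′ * (B ^^ suc j) (ι₂ m′) x)     ≡⟨ Σ<-idMˡ s (λ m′ → (B ^^ suc j) (ι₂ m′) x) (S m) ⟩
    (B ^^ suc j) (ι₂ (S m)) x                               ≡⟨ ^^-row₂ j (S m) x ⟩
    B (ι₂ (fold (S m) S j)) x                               ≡⟨ cong (λ u → B (ι₂ u) x) (fold-shift S m j) ⟩
    B (ι₂ (fold m S (suc j))) x                             ∎
    where open ≡-Reasoning

  ^^-row₁ : ∀ j f x → (B ^^ suc (suc j)) (ι₁ f) x ≡ Σ< s (λ m → X f m * B (ι₂ (fold m S j)) x)
  ^^-row₁ j f x = trans (^^-step j (ι₁ f) x) (Σ<-cong s (λ m → cong₂ _*_ (B₁₂ f m) (^^-row₂ j m x)))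

  fold-S-period : ∀ m → fold m S (suc d) ≡ m
  fold-S-period = fold-circSumSucc-period (suc d) ns (All.map proj₂ ns∣)

  ^^-period : (B ^^ suc (suc d)) ≈M B
  ^^-period i x with view i
  ... | in₃ t = trans (^^-row₃ (suc d) t x) (sym (row₃-zero t x))
  ... | in₂ m = trans (^^-row₂ (suc d) m x) (cong (λ u → B (ι₂ u) x) (fold-S-period m))
  ... | in₁ f with view x
  ...   | in₁ f′ = trans (^^-row₁ d f (ι₁ f′))
                     (trans (Σ<-zero s (λ m → trans (cong (X f m *_) (col₁-zero _ f′)) (*-zeroʳ (X f m))))
                            (sym (B₁₁ f f′)))
  ...   | in₂ m′ = begin
    (B ^^ suc (suc d)) (ι₁ f) (ι₂ m′)                  ≡⟨ ^^-row₁ d f (ι₂ m′) ⟩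
    Σ< s (λ m → X f m * B (ι₂ (fold m S d)) (ι₂ m′))   ≡⟨ Σ<-cong s (λ m → cong (X f m *_) (trans (B₂₂ _ m′)
                                                            (trans (circSum-idM ns _ m′) (cong (λ u → idM u m′) (fold-S-period m))))) ⟩
    Σ< s (λ m → X f m * idM m m′)                       ≡⟨ Σ<-cong s (λ m → cong (X f m *_) (idM-sym m m′)) ⟩
    Σ< s (λ m → X f m * idM m′ m)                       ≡⟨ Σ<-idMʳ s (X f) m′ ⟩
    X f m′                                              ≡⟨ B₁₂ f m′ ⟨
    B (ι₁ f) (ι₂ m′)                                    ∎
    where open ≡-Reasoning
  ...   | in₃ t = begin
    (B ^^ suc (suc d)) (ι₁ f) (ι₃ t)                   ≡⟨ ^^-row₁ d f (ι₃ t) ⟩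
    Σ< s (λ m → X f m * B (ι₂ (fold m S d)) (ι₃ t))    ≡⟨ Σ<-cong s (λ m → cong (X f m *_) (B₂₃ _ t)) ⟩
    Σ< s (λ m → X f m * Y (fold m S d) t)              ≡⟨ Σ<-circSumSucc d ns (All.map proj₂ ns∣) _ ⟩
    Σ< s (λ m → X f (S m) * Y (fold (S m) S d) t)      ≡⟨ Σ<-cong s (λ m → cong (λ u → X f (S m) * Y u t)
                                                            (trans (fold-shift S m d) (fold-S-period m))) ⟩
    Σ< s (λ m → X f (S m) * Y m t)                     ≡⟨ Σ<-cong s (λ m → cong (_* Y m t) (⊗-circSumᵀ ns X f m)) ⟨
    (X ⊗ (circSum ns ᵀ) ⊗ Y) f t                       ≡⟨ B₁₃ f t ⟨
    B (ι₁ f) (ι₃ t)                                    ∎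
    where open ≡-Reasoning

-- Nonnegative idempotent matrices

module Idempotent {n} (E : Mat n n) (E²≈E : (E ⊗ E) ≈M E) where

  infix 4 _↝_
  _↝_ : Fin n → Fin n → Set
  x ↝ y = 1 ≤ E x y

  ↝-trans : ∀ {x y z} → x ↝ y → y ↝ z → x ↝ z
  ↝-trans {x} {y} {z} x↝y y↝z =
    subst (1 ≤_) (E²≈E x z) (≤-trans (*-mono-≤ x↝y y↝z) (term≤Σ< n (λ m → E x m * E m z) y))

  ↝-split : ∀ {x z} → x ↝ z → ∃ λ y → x ↝ y × y ↝ z
  ↝-split {x} {z} x↝z with Σ<-positive n (λ m → E x m * E m z) (subst (1 ≤_) (sym (E²≈E x z)) x↝z)
  ... | y , p = y , *-positive⁻¹ (E x y) (E y z) p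

  loops-↝⇒≡ : ∀ {x y} → x ↝ x → y ↝ y → x ↝ y → x ≡ y
  loops-↝⇒≡ {x} {y} x↝x y↝y x↝y with x FP.≟ y
  ... | yes x≡y = x≡y
  ... | no  x≢y = ⊥-elim (<-irrefl (sym (E²≈E x y))
        (Σ<-exceeds n (λ m → E x m * E m y) x≢y (*-mono-≤ x↝x x↝y) (m≤m*n (E x y) (E y y) ⦃ >-nonZero y↝y ⦄)))

  module _ {x z} (x↝z : x ↝ z) where
    private
      chain : ℕ → ∃ λ y → y ↝ z
      chain zero    = x , x↝z
      chain (suc t) = map₂ proj₂ (↝-split (proj₂ (chain t)))

      point : ℕ → Fin n
      point = proj₁ ∘ chain

      point-step : ∀ t → point t ↝ point (suc t)
      point-step t = proj₁ (proj₂ (↝-split (proj₂ (chain t))))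

      point-↝ : ∀ s t → s < t → point s ↝ point t
      point-↝ s (suc t) s<1+t with m<1+n⇒m<n∨m≡n s<1+t
      ... | inj₁ s<t  = ↝-trans (point-↝ s t s<t) (point-step t)
      ... | inj₂ refl = point-step s

    -- Going backwards from z by ↝-split n times repeats a vertex, which lies on a loop.
    ↝-loopBetween : ∃ λ l → l ↝ l × x ↝ l × l ↝ z
    ↝-loopBetween with FP.pigeonhole (n<1+n n) (λ (i : Fin (suc n)) → point (toℕ i))
    ... | i , j , i<j , pi≡pj =
      point (toℕ i) ,
      subst (point (toℕ i) ↝_) (sym pi≡pj) (point-↝ (toℕ i) (toℕ j) i<j) ,
      subst (x ↝_) (sym pi≡pj) (point-↝ 0 (toℕ j) (≤-<-trans z≤n i<j)) ,
      proj₂ (chain (toℕ i))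

  ↝-through⇒loop : ∀ {u v w} → u ↝ v → v ↝ w → v ↝ v
  ↝-through⇒loop u↝v v↝w with ↝-loopBetween u↝v | ↝-loopBetween v↝w
  ... | l , l↝l , _ , l↝v | l′ , l′↝l′ , v↝l′ , _ =
    ↝-trans (subst (_ ↝_) (sym (loops-↝⇒≡ l↝l l′↝l′ (↝-trans l↝v v↝l′))) v↝l′) l↝v

-- The cycles of a 0-1 matrix with A^k = A

module CycleStructure {n} (A : Mat n n) (A-binary : IsBinary A) (d : ℕ)
                      (Aᵏ≈A : (A ^^ suc (suc d)) ≈M A) where

  E : Mat n n
  E = A ^^ suc d

  A⊗E≈A : (A ⊗ E) ≈M A
  A⊗E≈A = Aᵏ≈A

  E≈Aᵈ⊗A : E ≈M ((A ^^ d) ⊗ A)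
  E≈Aᵈ⊗A = ≈M-trans (^^-cong A (+-comm 1 d)) (≈M-trans (^^-+ A d 1) (⊗-cong (≈M-refl {A = A ^^ d}) (^^-1 A)))

  E⊗A≈A : (E ⊗ A) ≈M A
  E⊗A≈A = ≈M-trans (⊗-cong (≈M-refl {A = E}) (≈M-sym (^^-1 A)))
            (≈M-trans (≈M-sym (^^-+ A (suc d) 1)) (≈M-trans (^^-cong A (+-comm (suc d) 1)) Aᵏ≈A))

  -- E E = A^(d+1+d+1) = A^d A^(d+2) = A^d A = E
  E⊗E≈E : (E ⊗ E) ≈M E
  E⊗E≈E = ≈M-trans (≈M-sym (^^-+ A (suc d) (suc d)))
            (≈M-trans (^^-cong A (sym (+-suc d (suc d))))
            (≈M-trans (^^-+ A d (suc (suc d)))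
            (≈M-trans (⊗-cong (≈M-refl {A = A ^^ d}) Aᵏ≈A) (≈M-sym E≈Aᵈ⊗A))))

  open Idempotent E E⊗E≈E public

  infix 4 _⟶_
  _⟶_ : Fin n → Fin n → Set
  x ⟶ y = 1 ≤ A x y

  ⟶-binary : ∀ {x y} → x ⟶ y → A x y ≡ 1
  ⟶-binary {x} {y} x⟶y with A-binary x y
  ... | inj₁ Axy≡0 = ⊥-elim (<-irrefl (sym Axy≡0) x⟶y)
  ... | inj₂ Axy≡1 = Axy≡1

  OnCycle : Fin n → Set
  OnCycle x = x ↝ x

  onCycle? : ∀ x → Dec (OnCycle x)
  onCycle? x = 1 ≤? E x x

  ⟶⇒↝-into : ∀ {x y} → x ⟶ y → ∃ λ u → u ↝ y
  ⟶⇒↝-into {x} {y} x⟶y with Σ<-positive n (λ m → A x m * E m y) (subst (1 ≤_) (sym (A⊗E≈A x y)) x⟶y)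
  ... | u , p = u , proj₂ (*-positive⁻¹ (A x u) (E u y) p)

  ⟶⇒↝-out : ∀ {x y} → x ⟶ y → ∃ λ w → x ↝ w
  ⟶⇒↝-out {x} {y} x⟶y with Σ<-positive n (λ m → E x m * A m y) (subst (1 ≤_) (sym (E⊗A≈A x y)) x⟶y)
  ... | w , p = w , proj₁ (*-positive⁻¹ (E x w) (A w y) p)

  ⟶⟶⇒onCycle : ∀ {u v w} → u ⟶ v → v ⟶ w → OnCycle v
  ⟶⟶⇒onCycle u⟶v v⟶w = ↝-through⇒loop (proj₂ (⟶⇒↝-into u⟶v)) (proj₂ (⟶⇒↝-out v⟶w))

  Aᵈ-⟶⇒↝ : ∀ {x y z} → 1 ≤ (A ^^ d) y x → x ⟶ z → y ↝ z
  Aᵈ-⟶⇒↝ {x} {y} {z} p x⟶z = subst (1 ≤_) (sym (E≈Aᵈ⊗A y z))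
    (≤-trans (*-mono-≤ p x⟶z) (term≤Σ< n (λ m → (A ^^ d) y m * A m z) x))

  ⟶-Aᵈ⇒↝ : ∀ {x y z} → x ⟶ y → 1 ≤ (A ^^ d) y z → x ↝ z
  ⟶-Aᵈ⇒↝ {x} {y} {z} x⟶y p = ≤-trans (*-mono-≤ x⟶y p) (term≤Σ< n (λ m → A x m * (A ^^ d) m z) y)

  onCycle-next : ∀ {x} → OnCycle x → ∃ λ y → x ⟶ y × 1 ≤ (A ^^ d) y x
  onCycle-next {x} x↝x with Σ<-positive n (λ m → A x m * (A ^^ d) m x) x↝x
  ... | y , p = y , *-positive⁻¹ (A x y) _ p

  onCycle-prev : ∀ {y} → OnCycle y → ∃ λ x → 1 ≤ (A ^^ d) y x × x ⟶ y
  onCycle-prev {y} y↝y with Σ<-positive n (λ m → (A ^^ d) y m * A m y) (subst (1 ≤_) (E≈Aᵈ⊗A y y) y↝y)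
  ... | x , p = x , *-positive⁻¹ _ (A x y) p

  -- Both use A = A E (resp. A = E A): a second positive term in the expansion of A x y would make it exceed itself.
  ⟶-targets-≡ : ∀ {x l y} → x ⟶ l → x ⟶ y → l ↝ y → OnCycle y → l ≡ y
  ⟶-targets-≡ {x} {l} {y} x⟶l x⟶y l↝y y↝y with l FP.≟ y
  ... | yes l≡y = l≡y
  ... | no  l≢y = ⊥-elim (<-irrefl (sym (A⊗E≈A x y))
        (Σ<-exceeds n (λ m → A x m * E m y) l≢y (*-mono-≤ x⟶l l↝y) (m≤m*n (A x y) (E y y) ⦃ >-nonZero y↝y ⦄)))

  ⟶-sources-≡ : ∀ {x l y} → x ⟶ y → l ⟶ y → x ↝ l → OnCycle x → x ≡ l
  ⟶-sources-≡ {x} {l} {y} x⟶y l⟶y x↝l x↝x with l FP.≟ x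
  ... | yes l≡x = sym l≡x
  ... | no  l≢x = ⊥-elim (<-irrefl (sym (E⊗A≈A x y))
        (Σ<-exceeds n (λ m → E x m * A m y) l≢x (*-mono-≤ x↝l l⟶y) (m≤n*m (A x y) (E x x) ⦃ >-nonZero x↝x ⦄)))

  -- Off the cycles σ is the identity; only its values on cycles matter. It is opaque because
  -- unfolding it inside larger terms makes type checking prohibitively expensive.
  opaque
    σ : Fin n → Fin n
    σ x with FP.any? (λ y → (A x y ≟ 1) ×-dec onCycle? y)
    ... | yes (y , _) = y
    ... | no  _       = x

    σ-spec : ∀ {x} → OnCycle x → A x (σ x) ≡ 1 × OnCycle (σ x)
    σ-spec {x} x↝x with FP.any? (λ y → (A x y ≟ 1) ×-dec onCycle? y)
    ... | yes (_ , p) = p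
    ... | no  ∄y      with onCycle-next x↝x
    ...   | y , x⟶y , p = ⊥-elim (∄y (y , ⟶-binary x⟶y , Aᵈ-⟶⇒↝ p x⟶y))

  σ-⟶ : ∀ {x} → OnCycle x → x ⟶ σ x
  σ-⟶ x↝x = subst (1 ≤_) (sym (proj₁ (σ-spec x↝x))) (s≤s z≤n)

  σ-onCycle : ∀ {x} → OnCycle x → OnCycle (σ x)
  σ-onCycle x↝x = proj₂ (σ-spec x↝x)

  σ-unique : ∀ {x y} → OnCycle x → x ⟶ y → OnCycle y → y ≡ σ x
  σ-unique x↝x x⟶y y↝y with onCycle-next x↝x
  ... | l , x⟶l , p = trans (sym (⟶-targets-≡ x⟶l x⟶y (Aᵈ-⟶⇒↝ p x⟶y) y↝y))
                            (⟶-targets-≡ x⟶l (σ-⟶ x↝x) (Aᵈ-⟶⇒↝ p (σ-⟶ x↝x)) (σ-onCycle x↝x))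

  σ-injective : ∀ {x₁ x₂} → OnCycle x₁ → OnCycle x₂ → σ x₁ ≡ σ x₂ → x₁ ≡ x₂
  σ-injective {x₁} {x₂} x₁↝x₁ x₂↝x₂ σx₁≡σx₂ with onCycle-prev (σ-onCycle x₁↝x₁)
  ... | l , p , l⟶y = trans (⟶-sources-≡ x₁⟶y l⟶y (⟶-Aᵈ⇒↝ x₁⟶y p) x₁↝x₁)
                            (sym (⟶-sources-≡ x₂⟶y l⟶y (⟶-Aᵈ⇒↝ x₂⟶y p) x₂↝x₂))
    where
    x₁⟶y : x₁ ⟶ σ x₁
    x₁⟶y = σ-⟶ x₁↝x₁
    x₂⟶y : x₂ ⟶ σ x₁
    x₂⟶y = subst (x₂ ⟶_) (sym σx₁≡σx₂) (σ-⟶ x₂↝x₂)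

  offCycle-row-zero : ∀ {x y} → ¬ OnCycle y → x ⟶ y → ∀ z → A y z ≡ 0
  offCycle-row-zero {x} {y} y↝̸y x⟶y z with A-binary y z
  ... | inj₁ Ayz≡0 = Ayz≡0
  ... | inj₂ Ayz≡1 = ⊥-elim (y↝̸y (⟶⟶⇒onCycle x⟶y (subst (1 ≤_) (sym Ayz≡1) (s≤s z≤n))))

  ^^-zero-row : ∀ {y} → (∀ z → A y z ≡ 0) → ∀ j w → (A ^^ suc j) y w ≡ 0
  ^^-zero-row {y} Ay≡0 j w = Σ<-zero n (λ z → cong (_* (A ^^ j) z w) (Ay≡0 z))

  ^^-σ : ∀ {x} → OnCycle x → ∀ j w → (A ^^ suc (suc j)) x w ≡ (A ^^ suc j) (σ x) w
  ^^-σ {x} x↝x j w = begin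
    Σ< n (λ y → A x y * (A ^^ suc j) y w) ≡⟨ Σ<-single n _ (σ x) off-σ ⟩
    A x (σ x) * (A ^^ suc j) (σ x) w      ≡⟨ cong (_* (A ^^ suc j) (σ x) w) (proj₁ (σ-spec x↝x)) ⟩
    1 * (A ^^ suc j) (σ x) w              ≡⟨ *-identityˡ _ ⟩
    (A ^^ suc j) (σ x) w                  ∎
    where
    open ≡-Reasoning
    off-σ : ∀ y → y ≢ σ x → A x y * (A ^^ suc j) y w ≡ 0
    off-σ y y≢σx with A-binary x y | onCycle? y
    ... | inj₁ Axy≡0 | _      = cong (_* (A ^^ suc j) y w) Axy≡0
    ... | inj₂ Axy≡1 | yes y↝y = ⊥-elim (y≢σx (σ-unique x↝x (subst (1 ≤_) (sym Axy≡1) (s≤s z≤n)) y↝y))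
    ... | inj₂ Axy≡1 | no y↝̸y = trans (cong (A x y *_)
                                   (^^-zero-row (offCycle-row-zero y↝̸y (subst (1 ≤_) (sym Axy≡1) (s≤s z≤n))) j w))
                                   (*-zeroʳ (A x y))

  fold-σ-onCycle : ∀ {x} → OnCycle x → ∀ j → OnCycle (fold x σ j)
  fold-σ-onCycle = fold-preserves OnCycle σ-onCycle

  ^^-fold-σ : ∀ {x} → OnCycle x → ∀ j w → (A ^^ suc j) x w ≡ A (fold x σ j) w
  ^^-fold-σ {x} x↝x zero    w = ^^-1 A x w
  ^^-fold-σ {x} x↝x (suc j) w = begin
    (A ^^ suc (suc j)) x w  ≡⟨ ^^-σ x↝x j w ⟩
    (A ^^ suc j) (σ x) w    ≡⟨ ^^-fold-σ (σ-onCycle x↝x) j w ⟩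
    A (fold (σ x) σ j) w    ≡⟨ cong (λ u → A u w) (fold-shift σ x j) ⟩
    A (fold x σ (suc j)) w  ∎
    where open ≡-Reasoning

  fold-σ-period : ∀ {x} → OnCycle x → fold x σ (suc d) ≡ x
  fold-σ-period {x} x↝x = sym (σ-unique (fold-σ-onCycle x↝x d) (subst (1 ≤_) (^^-fold-σ x↝x d x) x↝x) x↝x)

  fold-σ-injective : ∀ {x y} → OnCycle x → OnCycle y → ∀ j → fold x σ j ≡ fold y σ j → x ≡ y
  fold-σ-injective x↝x y↝y zero    eq = eq
  fold-σ-injective x↝x y↝y (suc j) eq =
    fold-σ-injective x↝x y↝y j (σ-injective (fold-σ-onCycle x↝x j) (fold-σ-onCycle y↝y j) eq)

  E-σ : ∀ {x} → OnCycle x → ∀ w → E (σ x) w ≡ A x w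
  E-σ x↝x w = trans (sym (^^-σ x↝x d w)) (Aᵏ≈A _ w)

  module Orbit {x} (x↝x : OnCycle x) where

    private
      returns : ¬ (∀ (i : Fin (suc d)) → fold x σ (suc (toℕ i)) ≢ x)
      returns never = never (fromℕ d)
        (subst (λ u → fold x σ (suc u) ≡ x) (sym (FP.toℕ-fromℕ d)) (fold-σ-period x↝x))

    opaque
      minimalPeriod : ∃ λ p → fold x σ (suc p) ≡ x × (∀ r → r < p → fold x σ (suc r) ≢ x)
      minimalPeriod with FP.¬∀⟶∃¬-smallest (suc d) (λ i → fold x σ (suc (toℕ i)) ≢ x)
                           (λ i → ¬? (fold x σ (suc (toℕ i)) FP.≟ x)) returns
      ... | i , ¬¬return , earlier = toℕ i , decidable-stable (_ FP.≟ x) ¬¬return ,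
        λ r r<i → subst (λ u → fold x σ (suc u) ≢ x)
                        (trans (FP.toℕ-inject (fromℕ< r<i)) (FP.toℕ-fromℕ< r<i)) (earlier (fromℕ< r<i))

    p : ℕ
    p = proj₁ minimalPeriod

    L : ℕ
    L = suc p

    fold-σ-L : fold x σ L ≡ x
    fold-σ-L = proj₁ (proj₂ minimalPeriod)

    fold-σ-minimal : ∀ r → r < p → fold x σ (suc r) ≢ x
    fold-σ-minimal = proj₂ (proj₂ minimalPeriod)

    open PeriodicPoint σ {p = p} fold-σ-L public

    L∣period : L ∣ suc d
    L∣period = period-∣ fold-σ-minimal (suc d) (fold-σ-period x↝x)

    fold-σ-≢ : ∀ u k → u + suc k ≤ p → fold x σ u ≢ fold x σ (u + suc k)
    fold-σ-≢ u k bound eq = fold-σ-minimal k (≤-trans (m≤n+m (suc k) u) bound)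
      (sym (fold-σ-injective x↝x (fold-σ-onCycle x↝x (suc k)) u (trans eq (fold-+ x σ u))))

    orbit : Fin L → Fin n
    orbit i = fold x σ (toℕ i)

    orbit-< : ∀ {i j} → toℕ i < toℕ j → orbit i ≢ orbit j
    orbit-< {i} {j} i<j = fold-σ-≢ (toℕ i) k (subst (_≤ p) j≡i+1+k (s≤s⁻¹ (FP.toℕ<n j)))
                          ∘ subst (λ u → orbit i ≡ fold x σ u) j≡i+1+k
      where
      k : ℕ
      k = toℕ j ∸ suc (toℕ i)
      j≡i+1+k : toℕ j ≡ toℕ i + suc k
      j≡i+1+k = sym (trans (+-suc (toℕ i) k) (m+[n∸m]≡n i<j))

    orbit-injective : ∀ {i j} → orbit i ≡ orbit j → i ≡ j
    orbit-injective eq = FP.toℕ-injective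
      (≤-antisym (≮⇒≥ (λ j<i → orbit-< j<i (sym eq))) (≮⇒≥ (λ i<j → orbit-< i<j eq)))

    orbit-onCycle : ∀ i → OnCycle (orbit i)
    orbit-onCycle i = fold-σ-onCycle x↝x (toℕ i)

    σ-orbit : ∀ i → σ (orbit i) ≡ orbit (circSucc L i)
    σ-orbit i = trans (fold-% (suc (toℕ i))) (cong (fold x σ) (sym (toℕ-circSucc p i)))

    orbit-σ⁻¹ : ∀ i → ∃ λ j → σ (orbit j) ≡ orbit i
    orbit-σ⁻¹ fz     = fromℕ p , trans (cong (λ u → fold x σ (suc u)) (FP.toℕ-fromℕ p)) fold-σ-L
    orbit-σ⁻¹ (fs i) = inject₁ i , cong (λ u → fold x σ (suc u)) (FP.toℕ-inject₁ i)

    InOrbit : Fin n → Set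
    InOrbit y = ∃ λ i → orbit i ≡ y

    inOrbit? : ∀ y → Dec (InOrbit y)
    inOrbit? y = FP.any? (λ i → orbit i FP.≟ y)

    inOrbit-σ⁻¹ : ∀ {y} → OnCycle y → InOrbit (σ y) → InOrbit y
    inOrbit-σ⁻¹ y↝y (i , oi≡σy) =
      map₂ (λ {j} σoj≡oi → σ-injective (orbit-onCycle j) y↝y (trans σoj≡oi oi≡σy)) (orbit-σ⁻¹ i)

    orbit-enumeration : Enumeration InOrbit L
    orbit-enumeration = record
      { elem = orbit ; elem-injective = orbit-injective ; elem-∈ = λ i → i , refl ; elem-surjective = λ inO → inO }

  record CycleDecomposition (R : Fin n → Set) : Set where
    field
      lengths    : List ℕ
      lengths-∣  : All (λ m → 1 ≤ m × m ∣ suc d) lengths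
      vertices   : Enumeration R (sum lengths)
      σ-vertices : ∀ i → σ (Enumeration.elem vertices i) ≡ Enumeration.elem vertices (circSumSucc lengths i)

  module _ {R : Fin n → Set} (R-σ : ∀ {y} → R y → R (σ y)) {x} (Rx : R x) (x↝x : OnCycle x) where
    open Orbit x↝x

    cycleDecomposition-∷ : CycleDecomposition (λ y → R y × ¬ InOrbit y) → CycleDecomposition R
    cycleDecomposition-∷ D = record
      { lengths    = L ∷ lengths
      ; lengths-∣  = (s≤s z≤n , L∣period) ∷ lengths-∣
      ; vertices   = Enumeration-⇔ join split (Enumeration-++ (λ inO out → proj₂ out inO) orbit-enumeration vertices)
      ; σ-vertices = σ-++
      }
      where
      open CycleDecomposition D
      module V = Enumeration vertices
      join : ∀ {y} → InOrbit y ⊎ (R y × ¬ InOrbit y) → R y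
      join (inj₁ (i , oi≡y)) = subst R oi≡y (fold-preserves R R-σ Rx (toℕ i))
      join (inj₂ (Ry , _))   = Ry
      split : ∀ {y} → R y → InOrbit y ⊎ (R y × ¬ InOrbit y)
      split {y} Ry with inOrbit? y
      ... | yes inO = inj₁ inO
      ... | no  out = inj₂ (Ry , out)
      σ-++ : ∀ i → σ ((orbit ++ V.elem) i) ≡ (orbit ++ V.elem) (circSumSucc (L ∷ lengths) i)
      σ-++ i with splitView L (sum lengths) i
      ... | left i₁ = begin
        σ ((orbit ++ V.elem) (i₁ ↑ˡ sum lengths))                          ≡⟨ cong σ (lookup-++ˡ orbit V.elem i₁) ⟩
        σ (orbit i₁)                                                       ≡⟨ σ-orbit i₁ ⟩
        orbit (circSucc L i₁)                                              ≡⟨ lookup-++ˡ orbit V.elem (circSucc L i₁) ⟨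
        (orbit ++ V.elem) (circSucc L i₁ ↑ˡ sum lengths)                   ≡⟨ cong (orbit ++ V.elem) (circSumSucc-↑ˡ L lengths i₁) ⟨
        (orbit ++ V.elem) (circSumSucc (L ∷ lengths) (i₁ ↑ˡ sum lengths))  ∎
        where open ≡-Reasoning
      ... | right i₂ = begin
        σ ((orbit ++ V.elem) (L ↑ʳ i₂))                           ≡⟨ cong σ (lookup-++ʳ orbit V.elem i₂) ⟩
        σ (V.elem i₂)                                             ≡⟨ σ-vertices i₂ ⟩
        V.elem (circSumSucc lengths i₂)                           ≡⟨ lookup-++ʳ orbit V.elem (circSumSucc lengths i₂) ⟨
        (orbit ++ V.elem) (L ↑ʳ circSumSucc lengths i₂)           ≡⟨ cong (orbit ++ V.elem) (circSumSucc-↑ʳ L lengths i₂) ⟨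
        (orbit ++ V.elem) (circSumSucc (L ∷ lengths) (L ↑ʳ i₂))   ∎
        where open ≡-Reasoning

  cycleDecomposition : ∀ {R : Fin n → Set} → (∀ y → Dec (R y)) → (∀ {y} → R y → OnCycle y) →
                       (∀ {y} → R y → R (σ y)) → (xs : List (Fin n)) → (∀ {y} → R y → y ∈ xs) →
                       CycleDecomposition R
  cycleDecomposition R? R-onCycle R-σ [] R⊆[] = record
    { lengths    = []
    ; lengths-∣  = []
    ; vertices   = record { elem = λ () ; elem-injective = λ { {()} } ; elem-∈ = λ ()
                          ; elem-surjective = λ Ry → case R⊆[] Ry of λ () }
    ; σ-vertices = λ ()
    }
  cycleDecomposition {R} R? R-onCycle R-σ (x ∷ xs) R⊆x∷xs with R? x
  ... | no ¬Rx = cycleDecomposition R? R-onCycle R-σ xs R⊆xs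
    where
    R⊆xs : ∀ {y} → R y → y ∈ xs
    R⊆xs Ry with R⊆x∷xs Ry
    ... | here refl = ⊥-elim (¬Rx Ry)
    ... | there y∈xs = y∈xs
  ... | yes Rx = cycleDecomposition-∷ R-σ Rx (R-onCycle Rx)
    (cycleDecomposition (λ y → R? y ×-dec ¬? (inOrbit? y)) (R-onCycle ∘ proj₁) R′-σ xs R′⊆xs)
    where
    open Orbit (R-onCycle Rx)
    R′-σ : ∀ {y} → R y × ¬ InOrbit y → R (σ y) × ¬ InOrbit (σ y)
    R′-σ (Ry , out) = R-σ Ry , out ∘ inOrbit-σ⁻¹ (R-onCycle Ry)
    R′⊆xs : ∀ {y} → R y × ¬ InOrbit y → y ∈ xs
    R′⊆xs (Ry , out) with R⊆x∷xs Ry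
    ... | here refl  = ⊥-elim (out (fz , refl))
    ... | there y∈xs = y∈xs

module NormalForm {n} (A : Mat n n) (A-binary : IsBinary A) (d : ℕ) (Aᵏ≈A : (A ^^ suc (suc d)) ≈M A) where
  open CycleStructure A A-binary d Aᵏ≈A

  Source : Fin n → Set
  Source y = ¬ OnCycle y × (∀ x → A x y ≡ 0)

  Sink : Fin n → Set
  Sink y = ¬ OnCycle y × ∃ λ x → A x y ≡ 1

  sources : ∃ (Enumeration Source)
  sources = enumerate (λ y → ¬? (onCycle? y) ×-dec FP.all? (λ x → A x y ≟ 0))

  sinks : ∃ (Enumeration Sink)
  sinks = enumerate (λ y → ¬? (onCycle? y) ×-dec FP.any? (λ x → A x y ≟ 1))

  cycles : CycleDecomposition OnCycle
  cycles = cycleDecomposition onCycle? (λ y↝y → y↝y) σ-onCycle (allFin n) (λ {y} _ → ∈-allFin y)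

  open CycleDecomposition cycles using (lengths; lengths-∣; vertices; σ-vertices)

  a c s : ℕ
  a = proj₁ sources
  c = proj₁ sinks
  s = sum lengths

  source : Fin a → Fin n
  source = Enumeration.elem (proj₂ sources)
  cyclic : Fin s → Fin n
  cyclic = Enumeration.elem vertices
  sink : Fin c → Fin n
  sink = Enumeration.elem (proj₂ sinks)

  X : Mat a s
  X i j = A (source i) (cyclic j)

  Y : Mat s c
  Y i j = A (cyclic i) (sink j)

  classify : ∀ y → Source y ⊎ (OnCycle y ⊎ Sink y)
  classify y with onCycle? y | FP.any? (λ x → A x y ≟ 1)
  ... | yes y↝y | _         = inj₂ (inj₁ y↝y)
  ... | no  y↝̸y | yes hasIn = inj₂ (inj₂ (y↝̸y , hasIn))
  ... | no  y↝̸y | no  noIn  = inj₁ (y↝̸y , λ x → binary-≢1 (A-binary x y) (λ Axy≡1 → noIn (x , Axy≡1)))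
    where
    binary-≢1 : ∀ {v} → v ≡ 0 ⊎ v ≡ 1 → v ≢ 1 → v ≡ 0
    binary-≢1 (inj₁ v≡0) _   = v≡0
    binary-≢1 (inj₂ v≡1) v≢1 = ⊥-elim (v≢1 v≡1)

  everything : Enumeration (λ y → Source y ⊎ (OnCycle y ⊎ Sink y)) (a + (s + c))
  everything = Enumeration-++ source-disjoint (proj₂ sources)
                 (Enumeration-++ (λ y↝y (y↝̸y , _) → y↝̸y y↝y) vertices (proj₂ sinks))
    where
    source-disjoint : ∀ {y} → Source y → ¬ (OnCycle y ⊎ Sink y)
    source-disjoint (y↝̸y , _)    (inj₁ y↝y)            = y↝̸y y↝y
    source-disjoint (_ , noEdge) (inj₂ (_ , x , Axy≡1)) = case trans (sym Axy≡1) (noEdge x) of λ ()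

  π : Permutation n (a + (s + c))
  π = Enumeration-permutation classify everything

  open CanonicalForm d a c lengths lengths-∣ X Y hiding (s)

  from : Fin (a + (s + c)) → Fin n
  from = π ⟨$⟩ˡ_

  from-ι₁ : ∀ i → from (ι₁ i) ≡ source i
  from-ι₁ = lookup-++ˡ source (cyclic ++ sink)

  from-ι₂ : ∀ i → from (ι₂ i) ≡ cyclic i
  from-ι₂ i = trans (lookup-++ʳ source (cyclic ++ sink) (i ↑ˡ c)) (lookup-++ˡ cyclic sink i)

  from-ι₃ : ∀ i → from (ι₃ i) ≡ sink i
  from-ι₃ i = trans (lookup-++ʳ source (cyclic ++ sink) (s ↑ʳ i)) (lookup-++ʳ cyclic sink i)

  source-column : ∀ x i → A x (source i) ≡ 0
  source-column x i = proj₂ (Enumeration.elem-∈ (proj₂ sources) i) x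

  sink-row : ∀ i y → A (sink i) y ≡ 0
  sink-row i y with Enumeration.elem-∈ (proj₂ sinks) i
  ... | sink↝̸sink , x , Ax-sink≡1 = offCycle-row-zero sink↝̸sink (subst (1 ≤_) (sym Ax-sink≡1) (s≤s z≤n)) y

  cyclic-block : ∀ i j → A (cyclic i) (cyclic j) ≡ idM (S i) j
  cyclic-block i j with S i FP.≟ j
  ... | yes refl = trans (cong (A (cyclic i)) (sym (σ-vertices i))) (proj₁ (σ-spec (Enumeration.elem-∈ vertices i)))
  ... | no  Si≢j with A-binary (cyclic i) (cyclic j)
  ...   | inj₁ A≡0 = A≡0
  ...   | inj₂ A≡1 = ⊥-elim (Si≢j (sym (Enumeration.elem-injective vertices
                       (trans (σ-unique (Enumeration.elem-∈ vertices i) (subst (1 ≤_) (sym A≡1) (s≤s z≤n))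
                                        (Enumeration.elem-∈ vertices j))
                              (σ-vertices i)))))

  -- In A = A E only the cyclic vertices contribute: source columns of A and sink rows of E vanish.
  A≡Σ-cyclic : ∀ u w → A u w ≡ Σ< s (λ m → A u (cyclic m) * E (cyclic m) w)
  A≡Σ-cyclic u w = begin
    A u w                                              ≡⟨ A⊗E≈A u w ⟨
    Σ< n (λ y → A u y * E y w)                         ≡⟨ Σ<-permute _ (flip π) ⟩
    Σ< (a + (s + c)) (λ i → A u (from i) * E (from i) w) ≡⟨ Σ<-view _ ⟩
    Σ< a (λ i → A u (from (ι₁ i)) * E (from (ι₁ i)) w) +
      (Σ< s (λ m → A u (from (ι₂ m)) * E (from (ι₂ m)) w) + Σ< c (λ i → A u (from (ι₃ i)) * E (from (ι₃ i)) w))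
      ≡⟨ cong₂ (λ p q → p + (Σ< s (λ m → A u (from (ι₂ m)) * E (from (ι₂ m)) w) + q))
           (Σ<-zero a (λ i → trans (cong (λ v → A u v * E v w) (from-ι₁ i))
                                   (cong (_* E (source i) w) (source-column u i))))
           (Σ<-zero c (λ i → trans (cong (λ v → A u v * E v w) (from-ι₃ i))
                                   (trans (cong (A u (sink i) *_) (^^-zero-row (sink-row i) d w)) (*-zeroʳ (A u (sink i)))))) ⟩
    Σ< s (λ m → A u (from (ι₂ m)) * E (from (ι₂ m)) w) + 0
      ≡⟨ +-identityʳ _ ⟩
    Σ< s (λ m → A u (from (ι₂ m)) * E (from (ι₂ m)) w)
      ≡⟨ Σ<-cong s (λ m → cong (λ v → A u v * E v w) (from-ι₂ m)) ⟩
    Σ< s (λ m → A u (cyclic m) * E (cyclic m) w) ∎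
    where open ≡-Reasoning

  X⊗Pᵀ⊗Y≡A : ∀ i j → (X ⊗ (circSum lengths ᵀ) ⊗ Y) i j ≡ A (source i) (sink j)
  X⊗Pᵀ⊗Y≡A i j = sym (begin
    A (source i) (sink j)                                       ≡⟨ A≡Σ-cyclic _ _ ⟩
    Σ< s (λ m → A (source i) (cyclic m) * E (cyclic m) (sink j)) ≡⟨ Σ<-circSumSucc d lengths (All.map proj₂ lengths-∣) _ ⟩
    Σ< s (λ m → X i (S m) * E (cyclic (S m)) (sink j))           ≡⟨ Σ<-cong s (λ m → cong (X i (S m) *_) E-next) ⟩
    Σ< s (λ m → X i (S m) * Y m j)                               ≡⟨ Σ<-cong s (λ m → cong (_* Y m j) (⊗-circSumᵀ lengths X i m)) ⟨
    (X ⊗ (circSum lengths ᵀ) ⊗ Y) i j                            ∎)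
    where
    open ≡-Reasoning
    E-next : ∀ {m} → E (cyclic (S m)) (sink j) ≡ Y m j
    E-next {m} = trans (cong (λ v → E v (sink j)) (sym (σ-vertices m))) (E-σ (Enumeration.elem-∈ vertices m) (sink j))

  B≡A : ∀ i j → B i j ≡ A (from i) (from j)
  B≡A i j with view i | view j
  ... | _     | in₁ j₁ = trans (col₁-zero i j₁) (sym (trans (cong (A (from i)) (from-ι₁ j₁)) (source-column _ j₁)))
  ... | in₃ i₃ | _     = trans (row₃-zero i₃ j) (sym (trans (cong (λ v → A v (from j)) (from-ι₃ i₃)) (sink-row i₃ _)))
  ... | in₁ i₁ | in₂ j₂ = trans (B₁₂ i₁ j₂) (sym (cong₂ A (from-ι₁ i₁) (from-ι₂ j₂)))
  ... | in₁ i₁ | in₃ j₃ = trans (B₁₃ i₁ j₃) (trans (X⊗Pᵀ⊗Y≡A i₁ j₃) (sym (cong₂ A (from-ι₁ i₁) (from-ι₃ j₃))))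
  ... | in₂ i₂ | in₂ j₂ = trans (B₂₂ i₂ j₂) (trans (circSum-idM lengths i₂ j₂)
                            (trans (sym (cyclic-block i₂ j₂)) (sym (cong₂ A (from-ι₂ i₂) (from-ι₂ j₂)))))
  ... | in₂ i₂ | in₃ j₃ = trans (B₂₃ i₂ j₃) (sym (cong₂ A (from-ι₂ i₂) (from-ι₃ j₃)))

  normalForm : Σ ℕ λ a → Σ ℕ λ c → Σ (List ℕ) λ ns →
    All (λ m → 1 ≤ m × m ∣ suc d) ns ×
    Σ (Mat a (sum ns)) λ X → Σ (Mat (sum ns) c) λ Y →
      IsBinary X × IsBinary Y × IsBinary (X ⊗ (circSum ns ᵀ) ⊗ Y) ×
      PermSimilar A (block3 {a} {sum ns} {c} zeroM X (X ⊗ (circSum ns ᵀ) ⊗ Y) zeroM (circSum ns) Y zeroM zeroM zeroM)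
  normalForm = a , c , lengths , lengths-∣ , X , Y ,
    (λ _ _ → A-binary _ _) , (λ _ _ → A-binary _ _) ,
    (λ i j → subst (λ v → v ≡ 0 ⊎ v ≡ 1) (sym (X⊗Pᵀ⊗Y≡A i j)) (A-binary _ _)) ,
    π , (λ i j → trans (B≡A i j) (sym (permMat-conj π A i j)))

theorem2p4 : (k : ℕ) → 2 ≤ k → (n : ℕ) → (A : Mat n n) → IsBinary A →
    ((A ^^ k) ≈M A) ⇔
    (A ≈M zeroM ⊎
      Σ ℕ λ a → Σ ℕ λ c → Σ (List ℕ) λ ns →
        All (λ m → 1 ≤ m × m ∣ k ∸ 1) ns ×
        Σ (Mat a (sum ns)) λ X → Σ (Mat (sum ns) c) λ Y →
          IsBinary X × IsBinary Y × IsBinary (X ⊗ (circSum ns ᵀ) ⊗ Y) ×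
          PermSimilar A
            (block3 {a} {sum ns} {c}
               zeroM X (X ⊗ (circSum ns ᵀ) ⊗ Y)
               zeroM (circSum ns) Y
               zeroM zeroM zeroM))
theorem2p4 (suc (suc d)) (s≤s (s≤s z≤n)) n A A-binary = mk⇔
  (λ Aᵏ≈A → inj₂ (NormalForm.normalForm A A-binary d Aᵏ≈A))
  λ { (inj₁ A≈0) x y → trans (Σ<-zero n (λ l → cong (_* (A ^^ suc d) l y) (A≈0 x l))) (sym (A≈0 x y))
    ; (inj₂ (a , c , ns , ns∣ , X , Y , _ , _ , _ , A∼B)) →
        PermSimilar-^^ A∼B (suc (suc d)) (CanonicalForm.^^-period d a c ns ns∣ X Y) }
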